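{- The class of Eulerian digraphs is not well-quasi-ordered under the strong immersion relation; that is, there is an infinite sequence $G_1,G_2,\dots$ of Eulerian digraphs such that for no $i<j$ does $G_i$ strongly immerse into $G_j$.
   Context: All digraphs are finite and may contain loops and parallel edges. A digraph is Eulerian if every vertex has in-degree equal to its out-degree. A path in a digraph is a sequence $(e_1,\dots,e_m)$ of pairwise distinct edges with $\mathrm{head}(e_i)=\mathrm{tail}(e_{i+1})$ for $1\le i<m$ (vertices may repeat); it goes from $\mathrm{tail}(e_1)$ to $\mathrm{head}(e_m)$ and its internal vertices are $\mathrm{head}(e_1),\dots,\mathrm{head}(e_{m-1})$. An immersion of a digraph $H$ into a digraph $G$ is a map $\gamma$ that sends the vertices of $H$ injectively to vertices of $G$ and each edge $(u,v)$ of $H$ to a path of $G$ from $\gamma(u)$ to $\gamma(v)$, such that the paths assigned to distinct edges are edge-disjoint. The immersion is strong if no vertex of $\gamma(V(H))$ is an internal vertex of any path $\gamma(e)$, $e\in E(H)$. We write $H\hookrightarrow G$ if $H$ strongly immerses into $G$. -}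

module Defs where

open import Data.Nat using (ℕ)
open import Data.Fin using (Fin)
open import Data.Fin.Properties using (_≟_)
open import Data.List using (List; []; _∷_; length; filter; allFin)
open import Data.List.Relation.Unary.Unique.Propositional using (Unique)
open import Data.List.Membership.Propositional using (_∈_; _∉_)
open import Data.Product using (_×_)
open import Data.Sum using (_⊎_)
open import Data.Unit using (⊤)
open import Data.Empty using (⊥)
open import Relation.Nullary using (¬_)
open import Relation.Binary.PropositionalEquality using (_≡_; _≢_)
open import Function.Definitions using (Injective)

record Digraph : Set where
  field
    nV   : ℕ
    nE   : ℕ
    tail : Fin nE → Fin nV
    head : Fin nE → Fin nV
open Digraph public

outdeg : (G : Digraph) → Fin (nV G) → ℕ
outdeg G v = length (filter (λ e → tail G e ≟ v) (allFin (nE G)))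

indeg : (G : Digraph) → Fin (nV G) → ℕ
indeg G v = length (filter (λ e → head G e ≟ v) (allFin (nE G)))

Eulerian : Digraph → Set
Eulerian G = ∀ v → indeg G v ≡ outdeg G v

-- A (nonempty) edge sequence is written as its first edge e and the rest es.
module _ (G : Digraph) where
  Chain : Fin (nE G) → List (Fin (nE G)) → Set
  Chain e []       = ⊤
  Chain e (f ∷ fs) = (head G e ≡ tail G f) × Chain f fs

  lastEdge : Fin (nE G) → List (Fin (nE G)) → Fin (nE G)
  lastEdge e []       = e
  lastEdge e (f ∷ fs) = lastEdge f fs

  Internal : Fin (nE G) → List (Fin (nE G)) → Fin (nV G) → Set
  Internal e []       v = ⊥
  Internal e (f ∷ fs) v = (head G e ≡ v) ⊎ Internal f fs v

  IsPath : Fin (nE G) → List (Fin (nE G)) → Fin (nV G) → Fin (nV G) → Set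
  IsPath e es u v =
    Unique (e ∷ es) × Chain e es × (tail G e ≡ u) × (head G (lastEdge e es) ≡ v)

record StrongImmersion (H G : Digraph) : Set where
  field
    vmap      : Fin (nV H) → Fin (nV G)
    vinj      : Injective _≡_ _≡_ vmap
    pfirst    : Fin (nE H) → Fin (nE G)
    prest     : Fin (nE H) → List (Fin (nE G))
    isPath    : ∀ e → IsPath G (pfirst e) (prest e) (vmap (tail H e)) (vmap (head H e))
    disjoint  : ∀ e e' → e ≢ e' → ∀ x → x ∈ (pfirst e ∷ prest e) → x ∉ (pfirst e' ∷ prest e')
    strong    : ∀ e w → ¬ Internal G (pfirst e) (prest e) (vmap w)

_↪_ : Digraph → Digraph → Set
H ↪ G = StrongImmersion H G

-- Ladder n is the union of directed triangles hub → x → y → hub, one for each rung x → y of the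
-- cycle left₀ right₀ left₁ right₁ … left_{M-1} right_{M-1} left₀ (M = n + 2, rungs directed from
-- left to right) in which the rung left₀ → right₀ is doubled; a union of directed triangles is
-- Eulerian. In a strong immersion of a smaller ladder into a larger one the hub must go to the hub,
-- since every other vertex has out-degree at most 3. A rung then maps to a path between rim
-- vertices that avoids the hub, which can only be a single rung. The doubled rung fixes left₀ and
-- right₀, and walking around the cycle fixes left t and right t for every t; the rung
-- left₀ → right_{M-1} closing the smaller cycle then has no image in the larger one.
module Submission where

open import Defs
open import Data.Bool using (if_then_else_)
open import Data.Empty using (⊥; ⊥-elim)
open import Data.Fin using (Fin; zero; suc; _↑ˡ_; _↑ʳ_; splitAt; toℕ; fromℕ; inject₁; inject≤)
open import Data.Fin.Properties
  using ( _≟_; pigeonhole; <⇒≢; toℕ-injective; toℕ-fromℕ; toℕ-inject≤; toℕ-inject₁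
        ; fromℕ≢inject₁; inject₁-injective; ↑ˡ-injective; ↑ʳ-injective
        ; splitAt-↑ˡ; splitAt-↑ʳ; splitAt⁻¹-↑ˡ; splitAt⁻¹-↑ʳ )
open import Data.Fin.Induction using (<-weakInduction)
open import Data.List using ([]; _∷_; length; filter; tabulate)
open import Data.List.Relation.Unary.Any using (here)
open import Data.Nat as ℕ using (ℕ; _+_; _<_; z≤n; s≤s)
import Data.Nat.Properties as ℕₚ
open import Data.Product using (Σ; _×_; _,_; proj₁; proj₂)
open import Data.Sum using (_⊎_; inj₁; inj₂; [_,_]′) renaming (map to map⊎)
open import Function using (_∘_; const)
open import Relation.Nullary using (¬_; does; yes; no)
open import Relation.Binary.PropositionalEquality

indicator : ∀ {N} → Fin N → Fin N → ℕ
indicator x v = if does (x ≟ v) then 1 else 0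

count : ∀ {k N} → (Fin k → Fin N) → Fin N → ℕ
count {ℕ.zero}  h v = 0
count {ℕ.suc k} h v = indicator (h zero) v + count (h ∘ suc) v

length-filter-tabulate : ∀ {A : Set} {k N} (f : A → Fin N) (g : Fin k → A) (v : Fin N) →
                         length (filter (λ x → f x ≟ v) (tabulate g)) ≡ count (f ∘ g) v
length-filter-tabulate {k = ℕ.zero}  f g v = refl
length-filter-tabulate {k = ℕ.suc k} f g v with f (g zero) ≟ v
... | yes _ = cong ℕ.suc (length-filter-tabulate f (g ∘ suc) v)
... | no  _ = length-filter-tabulate f (g ∘ suc) v

count-cong : ∀ {k N} {h h′ : Fin k → Fin N} → (∀ i → h i ≡ h′ i) → ∀ v → count h v ≡ count h′ v
count-cong {ℕ.zero}  eq v = refl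
count-cong {ℕ.suc k} eq v =
  cong₂ _+_ (cong (λ x → indicator x v) (eq zero)) (count-cong (eq ∘ suc) v)

count-+ : ∀ m {n N} (h : Fin (m + n) → Fin N) v →
          count h v ≡ count (h ∘ (_↑ˡ n)) v + count (h ∘ (m ↑ʳ_)) v
count-+ ℕ.zero    h v = refl
count-+ (ℕ.suc m) h v =
  trans (cong (indicator (h zero) v +_) (count-+ m (h ∘ suc) v)) (sym (ℕₚ.+-assoc (indicator (h zero) v) _ _))

module Blocks (a b c : ℕ) where

  block₁ : Fin a → Fin (a + (b + c))
  block₁ i = i ↑ˡ (b + c)

  block₂ : Fin b → Fin (a + (b + c))
  block₂ j = a ↑ʳ (j ↑ˡ c)

  block₃ : Fin c → Fin (a + (b + c))
  block₃ l = a ↑ʳ (b ↑ʳ l)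

  case₃ : ∀ {X : Set} → (Fin a → X) → (Fin b → X) → (Fin c → X) → Fin (a + (b + c)) → X
  case₃ f g h x = [ f , [ g , h ]′ ∘ splitAt b ]′ (splitAt a x)

  module _ {X : Set} (f : Fin a → X) (g : Fin b → X) (h : Fin c → X) where

    case₃-block₁ : ∀ i → case₃ f g h (block₁ i) ≡ f i
    case₃-block₁ i rewrite splitAt-↑ˡ a i (b + c) = refl

    case₃-block₂ : ∀ j → case₃ f g h (block₂ j) ≡ g j
    case₃-block₂ j rewrite splitAt-↑ʳ a (b + c) (j ↑ˡ c) | splitAt-↑ˡ b j c = refl

    case₃-block₃ : ∀ l → case₃ f g h (block₃ l) ≡ h l
    case₃-block₃ l rewrite splitAt-↑ʳ a (b + c) (b ↑ʳ l) | splitAt-↑ʳ b c l = refl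

  data Block₃View : Fin (a + (b + c)) → Set where
    in₁ : ∀ i → Block₃View (block₁ i)
    in₂ : ∀ j → Block₃View (block₂ j)
    in₃ : ∀ l → Block₃View (block₃ l)

  block₃View : ∀ x → Block₃View x
  block₃View x with splitAt a x in eq
  ... | inj₁ i = subst Block₃View (splitAt⁻¹-↑ˡ eq) (in₁ i)
  ... | inj₂ y with splitAt b y in eq′
  ...   | inj₁ j = subst Block₃View (trans (cong (a ↑ʳ_) (splitAt⁻¹-↑ˡ eq′)) (splitAt⁻¹-↑ʳ eq)) (in₂ j)
  ...   | inj₂ l = subst Block₃View (trans (cong (a ↑ʳ_) (splitAt⁻¹-↑ʳ eq′)) (splitAt⁻¹-↑ʳ eq)) (in₃ l)

  block₁-injective : ∀ {i i′} → block₁ i ≡ block₁ i′ → i ≡ i′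
  block₁-injective = ↑ˡ-injective (b + c) _ _

  block₂-injective : ∀ {j j′} → block₂ j ≡ block₂ j′ → j ≡ j′
  block₂-injective = ↑ˡ-injective c _ _ ∘ ↑ʳ-injective a _ _

  block₃-injective : ∀ {l l′} → block₃ l ≡ block₃ l′ → l ≡ l′
  block₃-injective = ↑ʳ-injective b _ _ ∘ ↑ʳ-injective a _ _

  blockIndex : Fin (a + (b + c)) → Fin 3
  blockIndex = case₃ (const zero) (const (suc zero)) (const (suc (suc zero)))

  data SameBlock : Fin (a + (b + c)) → Fin (a + (b + c)) → Set where
    both₁ : ∀ i i′ → SameBlock (block₁ i) (block₁ i′)
    both₂ : ∀ j j′ → SameBlock (block₂ j) (block₂ j′)
    both₃ : ∀ l l′ → SameBlock (block₃ l) (block₃ l′)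

  viewIndex : ∀ {x} → Block₃View x → Fin 3
  viewIndex (in₁ _) = zero
  viewIndex (in₂ _) = suc zero
  viewIndex (in₃ _) = suc (suc zero)

  blockIndex-view : ∀ {x} (v : Block₃View x) → blockIndex x ≡ viewIndex v
  blockIndex-view (in₁ i) = case₃-block₁ _ _ _ i
  blockIndex-view (in₂ j) = case₃-block₂ _ _ _ j
  blockIndex-view (in₃ l) = case₃-block₃ _ _ _ l

  sameBlock : ∀ {x y} → blockIndex x ≡ blockIndex y → SameBlock x y
  sameBlock {x} {y} eq =
    sameView (block₃View x) (block₃View y)
      (trans (sym (blockIndex-view (block₃View x))) (trans eq (blockIndex-view (block₃View y))))
    where
    sameView : ∀ {x y} (v : Block₃View x) (w : Block₃View y) → viewIndex v ≡ viewIndex w → SameBlock x y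
    sameView (in₁ i) (in₁ i′) _ = both₁ i i′
    sameView (in₂ j) (in₂ j′) _ = both₂ j j′
    sameView (in₃ l) (in₃ l′) _ = both₃ l l′
    sameView (in₁ _) (in₂ _) ()
    sameView (in₁ _) (in₃ _) ()
    sameView (in₂ _) (in₁ _) ()
    sameView (in₂ _) (in₃ _) ()
    sameView (in₃ _) (in₁ _) ()
    sameView (in₃ _) (in₂ _) ()

  distinctBlocks : ∀ {x y p q} → blockIndex x ≡ p → blockIndex y ≡ q → p ≢ q → x ≢ y
  distinctBlocks x↦p y↦q p≢q x≡y = p≢q (trans (sym x↦p) (trans (cong blockIndex x≡y) y↦q))

  block₁≢block₂ : ∀ i j → block₁ i ≢ block₂ j
  block₁≢block₂ i j = distinctBlocks (case₃-block₁ _ _ _ i) (case₃-block₂ _ _ _ j) λ ()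

  block₁≢block₃ : ∀ i l → block₁ i ≢ block₃ l
  block₁≢block₃ i l = distinctBlocks (case₃-block₁ _ _ _ i) (case₃-block₃ _ _ _ l) λ ()

  block₂≢block₃ : ∀ j l → block₂ j ≢ block₃ l
  block₂≢block₃ j l = distinctBlocks (case₃-block₂ _ _ _ j) (case₃-block₃ _ _ _ l) λ ()

  count-case₃ : ∀ {N} (f : Fin a → Fin N) (g : Fin b → Fin N) (h : Fin c → Fin N) v →
                count (case₃ f g h) v ≡ count f v + (count g v + count h v)
  count-case₃ f g h v =
    trans (count-+ a (case₃ f g h) v)
          (cong₂ _+_ (count-cong (case₃-block₁ f g h) v)
                     (trans (count-+ b _ v)
                            (cong₂ _+_ (count-cong (case₃-block₂ f g h) v) (count-cong (case₃-block₃ f g h) v))))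

OutdegreeAtMost : (G : Digraph) → Fin (nV G) → ℕ → Set
OutdegreeAtMost G x c =
  Σ (Fin (nE G) → Fin c) λ κ → ∀ {g g′} → tail G g ≡ x → tail G g′ ≡ x → κ g ≡ κ g′ → g ≡ g′

module Fan {N k : ℕ} (hub : Fin N) (src tgt : Fin k → Fin N) where

  open Blocks k k k

  atHub : Fin k → Fin N
  atHub = const hub

  -- The triangle hub → src τ → tgt τ → hub consists of spokeOut τ, rung τ and spokeIn τ.
  digraph : Digraph
  digraph = record
    { nV = N ; nE = k + (k + k) ; tail = case₃ atHub src tgt ; head = case₃ src tgt atHub }

  spokeOut rung spokeIn : Fin k → Fin (nE digraph)
  spokeOut = block₁
  rung     = block₂
  spokeIn  = block₃

  edgeIndex : Fin (nE digraph) → Fin k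
  edgeIndex = case₃ (λ τ → τ) (λ τ → τ) (λ τ → τ)

  tail-spokeOut : ∀ τ → tail digraph (spokeOut τ) ≡ hub
  tail-spokeOut = case₃-block₁ atHub src tgt

  tail-rung : ∀ τ → tail digraph (rung τ) ≡ src τ
  tail-rung = case₃-block₂ atHub src tgt

  head-rung : ∀ τ → head digraph (rung τ) ≡ tgt τ
  head-rung = case₃-block₂ src tgt atHub

  tail-spokeIn : ∀ τ → tail digraph (spokeIn τ) ≡ tgt τ
  tail-spokeIn = case₃-block₃ atHub src tgt

  head-spokeIn : ∀ τ → head digraph (spokeIn τ) ≡ hub
  head-spokeIn = case₃-block₃ src tgt atHub

  rung-injective : ∀ {τ σ} → rung τ ≡ rung σ → τ ≡ σ
  rung-injective = block₂-injective

  spokeOut-injective : ∀ {τ σ} → spokeOut τ ≡ spokeOut σ → τ ≡ σ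
  spokeOut-injective = block₁-injective

  eulerian : Eulerian digraph
  eulerian v = begin
    indeg digraph v                                  ≡⟨ length-filter-tabulate (head digraph) (λ e → e) v ⟩
    count (head digraph) v                           ≡⟨ count-case₃ src tgt atHub v ⟩
    count src v + (count tgt v + count atHub v)      ≡⟨ sym (ℕₚ.+-assoc (count src v) _ _) ⟩
    count src v + count tgt v + count atHub v        ≡⟨ ℕₚ.+-comm _ (count atHub v) ⟩
    count atHub v + (count src v + count tgt v)      ≡⟨ sym (count-case₃ atHub src tgt v) ⟩
    count (tail digraph) v                           ≡⟨ sym (length-filter-tabulate (tail digraph) (λ e → e) v) ⟩
    outdeg digraph v                                 ∎
    where open ≡-Reasoning

  spokeInPath-meetsHub : ∀ τ rest → head digraph (lastEdge digraph (spokeIn τ) rest) ≢ hub →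
                         Internal digraph (spokeIn τ) rest hub
  spokeInPath-meetsHub τ []      ends≢hub = ⊥-elim (ends≢hub (head-spokeIn τ))
  spokeInPath-meetsHub τ (_ ∷ _) _        = inj₁ (head-spokeIn τ)

  outEdge-shape : ∀ {g x} → tail digraph g ≡ x → x ≢ hub →
                  Σ (Fin k) λ τ → (g ≡ rung τ × src τ ≡ x) ⊎ (g ≡ spokeIn τ × tgt τ ≡ x)
  outEdge-shape {g} g↦x x≢hub with block₃View g
  ... | in₁ τ = ⊥-elim (x≢hub (trans (sym g↦x) (tail-spokeOut τ)))
  ... | in₂ τ = τ , inj₁ (refl , trans (sym (tail-rung τ)) g↦x)
  ... | in₃ τ = τ , inj₂ (refl , trans (sym (tail-spokeIn τ)) g↦x)

  module _ (tgt≢hub : ∀ τ → tgt τ ≢ hub) (src≢tgt : ∀ τ σ → src τ ≢ tgt σ) where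

    hubAvoidingPath-isRung : ∀ {g rest u w} → IsPath digraph g rest u w → u ≢ hub → w ≢ hub →
                             ¬ Internal digraph g rest hub →
                             Σ (Fin k) λ τ → g ≡ rung τ × src τ ≡ u × tgt τ ≡ w
    hubAvoidingPath-isRung {g} (_ , _ , g↦u , _) u≢hub _ _ with block₃View g
    ... | in₁ τ = ⊥-elim (u≢hub (trans (sym g↦u) (tail-spokeOut τ)))
    hubAvoidingPath-isRung {rest = rest} (_ , _ , _ , last↦w) _ w≢hub avoids | in₃ τ =
      ⊥-elim (avoids (spokeInPath-meetsHub τ rest (λ e → w≢hub (trans (sym last↦w) e))))
    hubAvoidingPath-isRung {rest = []} (_ , _ , g↦u , g↦w) _ _ _ | in₂ τ =
      τ , refl , trans (sym (tail-rung τ)) g↦u , trans (sym (head-rung τ)) g↦w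
    hubAvoidingPath-isRung {rest = f ∷ fs} (_ , (link , _) , _ , last↦w) _ w≢hub avoids | in₂ τ
      with block₃View f
    ... | in₁ σ = ⊥-elim (tgt≢hub τ (trans (sym (head-rung τ)) (trans link (tail-spokeOut σ))))
    ... | in₂ σ = ⊥-elim (src≢tgt σ τ (trans (sym (tail-rung σ)) (trans (sym link) (head-rung τ))))
    ... | in₃ σ =
      ⊥-elim (avoids (inj₂ (spokeInPath-meetsHub σ fs (λ e → w≢hub (trans (sym last↦w) e)))))

    outdegreeAtMost : ∀ {x c} → x ≢ hub → (κ : Fin k → Fin c) →
                      (∀ {τ σ} → src τ ≡ src σ → κ τ ≡ κ σ → τ ≡ σ) →
                      (∀ {τ σ} → tgt τ ≡ tgt σ → κ τ ≡ κ σ → τ ≡ σ) →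
                      OutdegreeAtMost digraph x c
    outdegreeAtMost {x} x≢hub κ srcSeparated tgtSeparated = κ ∘ edgeIndex , separated
      where
      label : ∀ {τ σ} (e : Fin k → Fin (nE digraph)) → (∀ ρ → edgeIndex (e ρ) ≡ ρ) →
              κ (edgeIndex (e τ)) ≡ κ (edgeIndex (e σ)) → κ τ ≡ κ σ
      label {τ} {σ} e index same = trans (cong κ (sym (index τ))) (trans same (cong κ (index σ)))

      separated : ∀ {g g′} → tail digraph g ≡ x → tail digraph g′ ≡ x →
                  κ (edgeIndex g) ≡ κ (edgeIndex g′) → g ≡ g′
      separated g↦x g′↦x same with outEdge-shape g↦x x≢hub | outEdge-shape g′↦x x≢hub
      ... | τ , inj₁ (refl , τ↦x) | σ , inj₁ (refl , σ↦x) =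
        cong rung (srcSeparated (trans τ↦x (sym σ↦x)) (label rung (case₃-block₂ _ _ _) same))
      ... | τ , inj₂ (refl , τ↦x) | σ , inj₂ (refl , σ↦x) =
        cong spokeIn (tgtSeparated (trans τ↦x (sym σ↦x)) (label spokeIn (case₃-block₃ _ _ _) same))
      ... | τ , inj₁ (_ , τ↦x) | σ , inj₂ (_ , σ↦x) = ⊥-elim (src≢tgt τ σ (trans τ↦x (sym σ↦x)))
      ... | τ , inj₂ (_ , τ↦x) | σ , inj₁ (_ , σ↦x) = ⊥-elim (src≢tgt σ τ (trans σ↦x (sym τ↦x)))

module _ {H G : Digraph} (S : H ↪ G) where
  open StrongImmersion S

  pfirst-injective : ∀ {e e′} → pfirst e ≡ pfirst e′ → e ≡ e′
  pfirst-injective {e} {e′} same with e ≟ e′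
  ... | yes e≡e′ = e≡e′
  ... | no  e≢e′ = ⊥-elim (disjoint e e′ e≢e′ (pfirst e) (here refl) (here same))

  tail-pfirst : ∀ e → tail G (pfirst e) ≡ vmap (tail H e)
  tail-pfirst e = proj₁ (proj₂ (proj₂ (isPath e)))

  ↪-outdegree : ∀ {u m c} → c < m → (es : Fin m → Fin (nE H)) → (∀ {i j} → es i ≡ es j → i ≡ j) →
                (∀ i → tail H (es i) ≡ u) → ¬ OutdegreeAtMost G (vmap u) c
  ↪-outdegree {u} c<m es es-injective es↦u (κ , separated) with pigeonhole c<m (κ ∘ pfirst ∘ es)
  ... | i , j , i<j , same = <⇒≢ i<j (es-injective (pfirst-injective (separated (leaves i) (leaves j) same)))
    where
    leaves : ∀ i → tail G (pfirst (es i)) ≡ vmap u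
    leaves i = trans (tail-pfirst (es i)) (cong vmap (es↦u i))

inject₁≢suc : ∀ {m} (i : Fin m) → inject₁ i ≢ suc i
inject₁≢suc i eq = ℕₚ.1+n≢n (sym (trans (sym (toℕ-inject₁ i)) (cong toℕ eq)))

inject≤-inject₁ : ∀ {m n} (i : Fin m) .(p : ℕ.suc m ℕ.≤ ℕ.suc n) .(q : m ℕ.≤ n) →
                  inject≤ (inject₁ i) p ≡ inject₁ (inject≤ i q)
inject≤-inject₁ i p q = toℕ-injective (begin
  toℕ (inject≤ (inject₁ i) p) ≡⟨ toℕ-inject≤ (inject₁ i) p ⟩
  toℕ (inject₁ i)             ≡⟨ toℕ-inject₁ i ⟩
  toℕ i                       ≡⟨ toℕ-inject≤ i q ⟨
  toℕ (inject≤ i q)           ≡⟨ toℕ-inject₁ (inject≤ i q) ⟨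
  toℕ (inject₁ (inject≤ i q)) ∎)
  where open ≡-Reasoning

predMod : ∀ {m} → Fin (ℕ.suc m) → Fin (ℕ.suc m)
predMod {m} zero  = fromℕ m
predMod (suc t)   = inject₁ t

predMod-injective : ∀ {m} {s t : Fin (ℕ.suc m)} → predMod s ≡ predMod t → s ≡ t
predMod-injective {s = zero}  {zero}  _  = refl
predMod-injective {s = zero}  {suc t} eq = ⊥-elim (fromℕ≢inject₁ eq)
predMod-injective {s = suc s} {zero}  eq = ⊥-elim (fromℕ≢inject₁ (sym eq))
predMod-injective {s = suc s} {suc t} eq = cong suc (inject₁-injective eq)

predMod-irreflexive : ∀ {m} (t : Fin (ℕ.suc (ℕ.suc m))) → predMod t ≢ t
predMod-irreflexive zero    ()
predMod-irreflexive (suc t) = inject₁≢suc t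

module Ladder (n : ℕ) where

  M T : ℕ
  M = ℕ.suc (ℕ.suc n)
  T = ℕ.suc (M + M)

  open Blocks 1 M M

  hub : Fin T
  hub = block₁ zero

  left right : Fin M → Fin T
  left  = block₂
  right = block₃

  left-injective : ∀ {t s} → left t ≡ left s → t ≡ s
  left-injective = block₂-injective

  right-injective : ∀ {t s} → right t ≡ right s → t ≡ s
  right-injective = block₃-injective

  hub≢left : ∀ t → hub ≢ left t
  hub≢left = block₁≢block₂ zero

  hub≢right : ∀ t → hub ≢ right t
  hub≢right = block₁≢block₃ zero

  left≢right : ∀ t s → left t ≢ right s
  left≢right = block₂≢block₃

  -- Rungs are indexed by vertices: left t indexes left t → right t, right t indexes
  -- left t → right (t − 1 mod M), and the hub indexes the second copy of left₀ → right₀.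
  src tgt : Fin T → Fin T
  src = case₃ (λ _ → left zero) left left
  tgt = case₃ (λ _ → right zero) right (right ∘ predMod)

  open Fan hub src tgt public

  src-hub : src hub ≡ left zero
  src-hub = case₃-block₁ (λ _ → left zero) left left zero

  src-left : ∀ t → src (left t) ≡ left t
  src-left = case₃-block₂ (λ _ → left zero) left left

  src-right : ∀ t → src (right t) ≡ left t
  src-right = case₃-block₃ (λ _ → left zero) left left

  tgt-hub : tgt hub ≡ right zero
  tgt-hub = case₃-block₁ (λ _ → right zero) right (right ∘ predMod) zero

  tgt-left : ∀ t → tgt (left t) ≡ right t
  tgt-left = case₃-block₂ (λ _ → right zero) right (right ∘ predMod)

  tgt-right : ∀ t → tgt (right t) ≡ right (predMod t)
  tgt-right = case₃-block₃ (λ _ → right zero) right (right ∘ predMod)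

  Rung : Fin T → Fin T → Set
  Rung x y = Σ (Fin T) λ τ → src τ ≡ x × tgt τ ≡ y

  straightRung : ∀ t → Rung (left t) (right t)
  straightRung t = left t , src-left t , tgt-left t

  diagonalRung : ∀ t → Rung (left t) (right (predMod t))
  diagonalRung t = right t , src-right t , tgt-right t

  rung-shape : ∀ τ → Σ (Fin M) λ c → src τ ≡ left c × (tgt τ ≡ right c ⊎ tgt τ ≡ right (predMod c))
  rung-shape τ with block₃View τ
  ... | in₁ zero = zero , src-hub , inj₁ tgt-hub
  ... | in₂ t    = t , src-left t , inj₁ (tgt-left t)
  ... | in₃ t    = t , src-right t , inj₂ (tgt-right t)

  rung-from-left : ∀ {c y} → Rung (left c) y → y ≡ right c ⊎ y ≡ right (predMod c)
  rung-from-left (τ , τ↦left , τ↦y) with rung-shape τ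
  ... | c , τ↦leftc , ends rewrite left-injective (trans (sym τ↦left) τ↦leftc) =
    map⊎ (trans (sym τ↦y)) (trans (sym τ↦y)) ends

  rung-into-right : ∀ {x j} → Rung x (right j) → x ≡ left j ⊎ Σ (Fin M) λ c → x ≡ left c × predMod c ≡ j
  rung-into-right (τ , τ↦x , τ↦right) with rung-shape τ
  ... | c , τ↦left , inj₁ τ↦rc rewrite right-injective (trans (sym τ↦right) τ↦rc) =
    inj₁ (trans (sym τ↦x) τ↦left)
  ... | c , τ↦left , inj₂ τ↦rpc =
    inj₂ (c , trans (sym τ↦x) τ↦left , sym (right-injective (trans (sym τ↦right) τ↦rpc)))

  tgt-isRight : ∀ τ → Σ (Fin M) λ c → tgt τ ≡ right c
  tgt-isRight τ with rung-shape τ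
  ... | c , _ , inj₁ τ↦right = c , τ↦right
  ... | c , _ , inj₂ τ↦right = predMod c , τ↦right

  src≢hub : ∀ τ → src τ ≢ hub
  src≢hub τ τ↦hub with rung-shape τ
  ... | c , τ↦left , _ = hub≢left c (trans (sym τ↦hub) τ↦left)

  tgt≢hub : ∀ τ → tgt τ ≢ hub
  tgt≢hub τ τ↦hub with tgt-isRight τ
  ... | c , τ↦right = hub≢right c (trans (sym τ↦hub) τ↦right)

  src≢tgt : ∀ τ σ → src τ ≢ tgt σ
  src≢tgt τ σ same with rung-shape τ | tgt-isRight σ
  ... | c , τ↦left , _ | d , σ↦right = left≢right c d (trans (sym τ↦left) (trans same σ↦right))

  src-separated : ∀ {τ σ} → src τ ≡ src σ → blockIndex τ ≡ blockIndex σ → τ ≡ σ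
  src-separated {τ} {σ} same sameIndex with sameBlock {τ} {σ} sameIndex
  ... | both₁ zero zero = refl
  ... | both₂ t s = cong left (left-injective (trans (sym (src-left t)) (trans same (src-left s))))
  ... | both₃ t s = cong right (left-injective (trans (sym (src-right t)) (trans same (src-right s))))

  tgt-separated : ∀ {τ σ} → tgt τ ≡ tgt σ → blockIndex τ ≡ blockIndex σ → τ ≡ σ
  tgt-separated {τ} {σ} same sameIndex with sameBlock {τ} {σ} sameIndex
  ... | both₁ zero zero = refl
  ... | both₂ t s = cong left (right-injective (trans (sym (tgt-left t)) (trans same (tgt-left s))))
  ... | both₃ t s =
    cong right (predMod-injective (right-injective (trans (sym (tgt-right t)) (trans same (tgt-right s)))))

  -- A rim vertex is an endpoint of at most one rung indexed from each of the three blocks.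
  outdegree≤3 : ∀ {x} → x ≢ hub → OutdegreeAtMost digraph x 3
  outdegree≤3 x≢hub = outdegreeAtMost tgt≢hub src≢tgt x≢hub blockIndex src-separated tgt-separated

  3<T : 3 < T
  3<T = s≤s (ℕₚ.+-mono-≤ {2} {M} (s≤s (s≤s z≤n)) (s≤s z≤n))

  parallel-rungs : ∀ {τ σ} → τ ≢ σ → src τ ≡ src σ → tgt τ ≡ tgt σ →
                   src τ ≡ left zero × tgt τ ≡ right zero
  parallel-rungs {τ} {σ} τ≢σ sameSrc sameTgt with block₃View τ | block₃View σ
  ... | in₁ zero | _        = src-hub , tgt-hub
  ... | _        | in₁ zero = trans sameSrc src-hub , trans sameTgt tgt-hub
  ... | in₂ t    | in₂ s    =
    ⊥-elim (τ≢σ (cong left (left-injective (trans (sym (src-left t)) (trans sameSrc (src-left s))))))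
  ... | in₃ t    | in₃ s    =
    ⊥-elim (τ≢σ (cong right (left-injective (trans (sym (src-right t)) (trans sameSrc (src-right s))))))
  ... | in₂ t    | in₃ s
    with refl ← left-injective (trans (sym (src-left t)) (trans sameSrc (src-right s))) =
    ⊥-elim (predMod-irreflexive t
      (sym (right-injective (trans (sym (tgt-left t)) (trans sameTgt (tgt-right t))))))
  ... | in₃ t    | in₂ s
    with refl ← left-injective (trans (sym (src-right t)) (trans sameSrc (src-left s))) =
    ⊥-elim (predMod-irreflexive t
      (right-injective (trans (sym (tgt-right t)) (trans sameTgt (tgt-left t)))))

module NoImmersion {a b : ℕ} (a<b : a < b) (S : Ladder.digraph a ↪ Ladder.digraph b) where
  module H = Ladder a
  module G = Ladder b
  open StrongImmersion S

  hub-fixed : vmap H.hub ≡ G.hub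
  hub-fixed with vmap H.hub ≟ G.hub
  ... | yes fixed = fixed
  ... | no  moved =
    ⊥-elim (↪-outdegree S H.3<T H.spokeOut H.spokeOut-injective H.tail-spokeOut (G.outdegree≤3 moved))

  avoidsHub : ∀ {x} → x ≢ H.hub → vmap x ≢ G.hub
  avoidsHub x≢hub x↦hub = x≢hub (vinj (trans x↦hub (sym hub-fixed)))

  rungImage : ∀ {x y} (ρ : H.Rung x y) →
              Σ (G.Rung (vmap x) (vmap y)) λ ρ′ → pfirst (H.rung (proj₁ ρ)) ≡ G.rung (proj₁ ρ′)
  rungImage (τ , τ↦x , τ↦y)
    with G.hubAvoidingPath-isRung G.tgt≢hub G.src≢tgt (isPath (H.rung τ))
           (avoidsHub (H.src≢hub τ ∘ trans (sym (H.tail-rung τ))))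
           (avoidsHub (H.tgt≢hub τ ∘ trans (sym (H.head-rung τ))))
           (subst (¬_ ∘ Internal G.digraph (pfirst (H.rung τ)) (prest (H.rung τ))) hub-fixed
                  (strong (H.rung τ) H.hub))
  ... | σ , first≡ , σ↦x , σ↦y =
    ( σ
    , trans σ↦x (cong vmap (trans (H.tail-rung τ) τ↦x))
    , trans σ↦y (cong vmap (trans (H.head-rung τ) τ↦y)) ) ,
    first≡

  mapRung : ∀ {x y x′ y′} → H.Rung x y → vmap x ≡ x′ → vmap y ≡ y′ → G.Rung x′ y′
  mapRung ρ x↦x′ y↦y′ with rungImage ρ
  ... | (σ , σ↦x , σ↦y) , _ = σ , trans σ↦x x↦x′ , trans σ↦y y↦y′

  M≤M : H.M ℕ.≤ G.M
  M≤M = s≤s (s≤s (ℕₚ.<⇒≤ a<b))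

  ι : Fin H.M → Fin G.M
  ι t = inject≤ t M≤M

  ι-predMod : ∀ i → ι (inject₁ i) ≡ predMod (ι (suc i))
  ι-predMod i = inject≤-inject₁ i _ _

  Aligned : Fin H.M → Set
  Aligned t = vmap (H.left t) ≡ G.left (ι t) × vmap (H.right t) ≡ G.right (ι t)

  -- The two copies of left₀ → right₀ map to distinct parallel rungs, which exist only there.
  aligned-zero : Aligned zero
  aligned-zero with rungImage (H.hub , H.src-hub , H.tgt-hub) | rungImage (H.straightRung zero)
  ... | (σ , σ↦left , σ↦right) , σ-first | (σ′ , σ′↦left , σ′↦right) , σ′-first =
    trans (sym σ↦left) (proj₁ corner) , trans (sym σ↦right) (proj₂ corner)
    where
    distinct : σ ≢ σ′
    distinct σ≡σ′ = H.hub≢left zero (H.rung-injective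
      (pfirst-injective S (trans σ-first (trans (cong G.rung σ≡σ′) (sym σ′-first)))))

    corner : G.src σ ≡ G.left zero × G.tgt σ ≡ G.right zero
    corner = G.parallel-rungs distinct (trans σ↦left (sym σ′↦left)) (trans σ↦right (sym σ′↦right))

  aligned-suc : ∀ i → Aligned (inject₁ i) → Aligned (suc i)
  aligned-suc i (leftᵢ , rightᵢ) = left-suc , right-suc
    where
    left-suc : vmap (H.left (suc i)) ≡ G.left (ι (suc i))
    left-suc with G.rung-into-right (mapRung (H.diagonalRung (suc i)) refl rightᵢ)
    ... | inj₁ toLeftᵢ =
      ⊥-elim (inject₁≢suc i (sym (H.left-injective (vinj (trans toLeftᵢ (sym leftᵢ))))))
    ... | inj₂ (c , toLeftc , c↦ιi) =
      trans toLeftc (cong G.left (predMod-injective (trans c↦ιi (ι-predMod i))))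

    right-suc : vmap (H.right (suc i)) ≡ G.right (ι (suc i))
    right-suc with G.rung-from-left (mapRung (H.straightRung (suc i)) left-suc refl)
    ... | inj₁ toRight = toRight
    ... | inj₂ toRightPred =
      ⊥-elim (inject₁≢suc i (sym (H.right-injective
        (vinj (trans toRightPred (trans (cong G.right (sym (ι-predMod i))) (sym rightᵢ)))))))

  aligned : ∀ t → Aligned t
  aligned = <-weakInduction Aligned aligned-zero aligned-suc

  toℕ-ι-fromℕ : toℕ (ι (fromℕ (ℕ.suc a))) ≡ ℕ.suc a
  toℕ-ι-fromℕ = trans (toℕ-inject≤ (fromℕ (ℕ.suc a)) M≤M) (toℕ-fromℕ (ℕ.suc a))

  no-wrapping-rung : ¬ G.Rung (G.left zero) (G.right (ι (fromℕ (ℕ.suc a))))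
  no-wrapping-rung ρ with G.rung-from-left ρ
  ... | inj₁ toZero =
    ℕₚ.0≢1+n (trans (cong toℕ (sym (G.right-injective toZero))) toℕ-ι-fromℕ)
  ... | inj₂ toEnd =
    ℕₚ.<⇒≢ a<b (ℕₚ.suc-injective
      (trans (sym toℕ-ι-fromℕ) (trans (cong toℕ (G.right-injective toEnd)) (toℕ-fromℕ (ℕ.suc b)))))

  impossible : ⊥
  impossible = no-wrapping-rung
    (mapRung (H.diagonalRung zero) (proj₁ aligned-zero) (proj₂ (aligned (fromℕ (ℕ.suc a)))))

theorem1p1 : Σ (ℕ → Digraph) (λ G → (∀ i → Eulerian (G i)) × (∀ i j → i < j → ¬ (G i ↪ G j)))
theorem1p1 = Ladder.digraph , Ladder.eulerian , λ i j i<j S → NoImmersion.impossible i<j S
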